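{- Every positive point-halfplane incidence graph contains no edge-asteroid triple.
   Context: A halfplane is a set $h=\{x\in\mathbb{R}^2:\langle w_h,x\rangle\le t_h\}$ with $w_h\neq0$ (its normal vector). For a set $P$ of points and a set $H$ of halfplanes in $\mathbb{R}^2$, $G(P,H)$ is the bipartite graph with parts $P,H$ and edges $ph$ for $p\in h$. A graph is a positive point-halfplane incidence graph if it is isomorphic to some $G(P,H)$ in which the normal vectors of all halfplanes in $H$ have pairwise non-negative dot products. An edge-asteroid triple in a graph is a set of three edges such that for each pair of them there is a path in the graph containing both edges of the pair and containing no vertex adjacent to an end-vertex of the third edge. -}

module Defs where

open import Level using (0ℓ)
open import Data.Nat using (ℕ)
open import Data.Fin using (Fin)
open import Data.Product using (Σ; ∃; ∃₂; _×_; _,_; proj₁; proj₂)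
open import Data.Sum using (_⊎_)
open import Data.List using (List; _∷_; _++_)
open import Data.List.Relation.Unary.All using (All)
open import Data.List.Relation.Unary.Unique.Propositional using (Unique)
open import Data.List.Relation.Unary.Linked using (Linked)
open import Relation.Nullary using (¬_)
open import Relation.Binary.PropositionalEquality using (_≡_; _≢_)
open import Relation.Binary.Structures using (IsTotalOrder)
open import Algebra.Structures using (IsCommutativeRing)
open import Function.Bundles using (_↔_; Inverse)
open import Function.Definitions using (Injective)

-- The real numbers, axiomatised as a complete ordered field
-- (any such structure is isomorphic to ℝ).

record RealField : Set₁ where
  infixl 6 _+_
  infixl 7 _*_
  field
    Carrier : Set
    _+_ _*_ : Carrier → Carrier → Carrier
    -_      : Carrier → Carrier
    0# 1#   : Carrier
    isCommutativeRing : IsCommutativeRing _≡_ _+_ _*_ -_ 0# 1#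
    0≢1     : 0# ≢ 1#
    inverse : ∀ x → x ≢ 0# → ∃ λ y → x * y ≡ 1#
    _≤_     : Carrier → Carrier → Set
    isTotalOrder : IsTotalOrder _≡_ _≤_
    +-mono-≤ : ∀ {x y} z → x ≤ y → (x + z) ≤ (y + z)
    *-nonneg : ∀ {x y} → 0# ≤ x → 0# ≤ y → 0# ≤ (x * y)
    complete : (S : Carrier → Set) → ∃ S →
               (∃ λ b → ∀ x → S x → x ≤ b) →
               ∃ λ s → (∀ x → S x → x ≤ s) ×
                       (∀ b → (∀ x → S x → x ≤ b) → s ≤ b)

record Graph : Set₁ where
  field
    V     : Set
    Adj   : V → V → Set
    sym   : ∀ {x y} → Adj x y → Adj y x
    irrefl : ∀ {x} → ¬ Adj x x

open Graph public

record _≅_ (G H : Graph) : Set where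
  field
    bij : V G ↔ V H
  to : V G → V H
  to = Inverse.to bij
  field
    adj-to   : ∀ u v → Adj G u v → Adj H (to u) (to v)
    adj-from : ∀ u v → Adj H (to u) (to v) → Adj G u v

module Geometry (ℝ : RealField) where
  open RealField ℝ

  Point : Set
  Point = Carrier × Carrier

  origin : Point
  origin = 0# , 0#

  ⟨_,_⟩ : Point → Point → Carrier
  ⟨ a , b ⟩ = proj₁ a * proj₁ b + proj₂ a * proj₂ b

  record Halfplane : Set where
    field
      w    : Point
      w≢0  : w ≢ origin
      t    : Carrier

  open Halfplane public

  _∈ₕ_ : Point → Halfplane → Set
  x ∈ₕ h = ⟨ w h , x ⟩ ≤ t h

  SameSet : Halfplane → Halfplane → Set
  SameSet h h' = ∀ x → (x ∈ₕ h → x ∈ₕ h') × (x ∈ₕ h' → x ∈ₕ h)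

  -- A finite set P of points and a finite set H of halfplanes, given by
  -- injective enumerations (halfplanes distinct as sets of points).
  record Config : Set where
    field
      a b   : ℕ
      pt    : Fin a → Point
      pt-inj : Injective _≡_ _≡_ pt
      hp    : Fin b → Halfplane
      hp-distinct : ∀ i j → SameSet (hp i) (hp j) → i ≡ j

  open Config public

  data IncAdj (C : Config) : (Fin (a C) ⊎ Fin (b C)) → (Fin (a C) ⊎ Fin (b C)) → Set where
    ph : ∀ i j → pt C i ∈ₕ hp C j → IncAdj C (_⊎_.inj₁ i) (_⊎_.inj₂ j)
    hp′ : ∀ i j → pt C i ∈ₕ hp C j → IncAdj C (_⊎_.inj₂ j) (_⊎_.inj₁ i)

  IncGraph : Config → Graph
  IncGraph C = record
    { V = Fin (a C) ⊎ Fin (b C)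
    ; Adj = IncAdj C
    ; sym = λ { (ph i j x) → hp′ i j x ; (hp′ i j x) → ph i j x }
    ; irrefl = λ () }

  Positive : Config → Set
  Positive C = ∀ i j → 0# ≤ ⟨ w (hp C i) , w (hp C j) ⟩

PositivePHIGraph : RealField → Graph → Set
PositivePHIGraph ℝ G =
  ∃ λ (C : Config) → Positive C × (G ≅ IncGraph C)
  where open Geometry ℝ

module _ (G : Graph) where

  record Edge : Set where
    constructor edge
    field
      u v : V G
      uv  : Adj G u v

  open Edge

  SameEdge : Edge → Edge → Set
  SameEdge e f = (u e ≡ u f × v e ≡ v f) ⊎ (u e ≡ v f × v e ≡ u f)

  IsPath : List (V G) → Set
  IsPath xs = Unique xs × Linked (Adj G) xs

  ContainsEdge : List (V G) → Edge → Set
  ContainsEdge xs e = ∃₂ λ ys zs →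
    (xs ≡ ys ++ u e ∷ v e ∷ zs) ⊎ (xs ≡ ys ++ v e ∷ u e ∷ zs)

  AdjToEnd : Edge → V G → Set
  AdjToEnd e x = Adj G x (u e) ⊎ Adj G x (v e)

  GoodPath : Edge → Edge → Edge → Set
  GoodPath e f g = ∃ λ xs → IsPath xs × ContainsEdge xs e × ContainsEdge xs f
                          × All (λ x → ¬ AdjToEnd g x) xs

  IsEdgeAsteroidTriple : Edge → Edge → Edge → Set
  IsEdgeAsteroidTriple e₁ e₂ e₃ =
    ¬ SameEdge e₁ e₂ × ¬ SameEdge e₁ e₃ × ¬ SameEdge e₂ e₃ ×
    GoodPath e₁ e₂ e₃ × GoodPath e₁ e₃ e₂ × GoodPath e₂ e₃ e₁

  HasEdgeAsteroidTriple : Set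
  HasEdgeAsteroidTriple = ∃ λ e₁ → ∃ λ e₂ → ∃ λ e₃ → IsEdgeAsteroidTriple e₁ e₂ e₃

{-# OPTIONS --safe #-}
-- Anchor at an edge (p, h) and measure a point y by side h p y = w_h × (y − p), whose sign tells
-- on which side of the line through p spanned by w_h the point y lies. If y ∉ h lies in a
-- halfplane k with p ∉ k, the Binet–Cauchy identity and ⟨w_k, w_h⟩ ≥ 0 force this sign to be
-- that of −(w_h × w_k); hence all points of a path avoiding the neighbourhood of (p, h) lie on
-- one side. For edges (pᵢ, hᵢ), (pⱼ, hⱼ) with pⱼ ∉ hᵢ and pᵢ ∉ hⱼ the signs of side hᵢ pᵢ pⱼ and
-- side hⱼ pⱼ pᵢ are opposite. An edge-asteroid triple therefore yields six numbers joined in a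
-- cycle by three sign agreements and three sign reversals, which is impossible.
module Submission where

open import Defs hiding (sym)
open import Level using (0ℓ)
open import Algebra.Bundles using (CommutativeRing)
open import Algebra.Solver.Ring.AlmostCommutativeRing
  using (_-Raw-AlmostCommutative⟶_; fromCommutativeRing; Induced-equivalence)
open import Data.Empty using (⊥; ⊥-elim)
open import Data.Fin using (Fin)
open import Data.Integer as ℤ using (ℤ; +_; -[1+_]; _⊖_; ∣_∣; _◃_)
import Data.Integer.Properties as ℤ
open import Data.List using (List; []; _∷_; _++_; map)
open import Data.List.Membership.Propositional using (_∈_)
open import Data.List.Membership.Propositional.Properties using (∈-++⁺ʳ)
open import Data.List.Properties using (map-++)
open import Data.List.Relation.Unary.All as All using (All; _∷_)
import Data.List.Relation.Unary.All.Properties as All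
open import Data.List.Relation.Unary.Any using (here; there)
open import Data.List.Relation.Unary.Linked as Linked using (Linked; []; [-]; _∷_)
import Data.List.Relation.Unary.Linked.Properties as Linked
import Data.List.Relation.Unary.Unique.Propositional.Properties as Unique
open import Data.Maybe using (just; nothing)
open import Data.Nat as ℕ using (ℕ; zero; suc)
import Data.Nat.Properties as ℕ
open import Data.Product using (∃; ∃₂; _×_; _,_; proj₁; proj₂)
import Data.Product as Product
open import Data.Sign as Sign using (Sign)
open import Data.Sum using (_⊎_; inj₁; inj₂)
import Data.Sum as Sum
open import Function using (_∘_; _on_)
open import Function.Bundles using (Injection)
open import Function.Properties.Inverse using (↔⇒↣)
open import Relation.Binary.Bundles using (Poset)
open import Relation.Binary.Definitions using (WeaklyDecidable; Symmetric; Transitive)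
open import Relation.Binary.PropositionalEquality as ≡ using (_≡_; _≢_)
open import Relation.Binary.Structures using (IsTotalOrder)
open import Relation.Nullary using (¬_; yes; no)

-- The ring solver needs coefficients with decidable equality: use ℤ, which maps into every
-- commutative ring.
module IntegerCoefficients {c ℓ} (R : CommutativeRing c ℓ) where
  open CommutativeRing R
  open import Algebra.Properties.Ring ring
    using (-0#≈0#; -‿involutive; -‿+-comm; -‿distribˡ-*; -‿distribʳ-*)
  open import Algebra.Properties.Semiring.Mult semiring using (×-homo-+; ×1-homo-*)
    renaming (_×_ to _×ₙ_)
  open import Relation.Binary.Reasoning.Setoid setoid

  fromℕ : ℕ → Carrier
  fromℕ n = n ×ₙ 1#

  fromℤ : ℤ → Carrier
  fromℤ (+ n)    = fromℕ n
  fromℤ -[1+ n ] = - fromℕ (suc n)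

  fromℤ-‿homo : ∀ i → fromℤ (ℤ.- i) ≈ - fromℤ i
  fromℤ-‿homo (+ zero)  = sym -0#≈0#
  fromℤ-‿homo (+ suc n) = refl
  fromℤ-‿homo -[1+ n ]  = sym (-‿involutive _)

  [1+x]-[1+y]≈x-y : ∀ x y → (1# + x) - (1# + y) ≈ x - y
  [1+x]-[1+y]≈x-y x y = begin
    (1# + x) + - (1# + y)    ≈⟨ +-congˡ (sym (-‿+-comm 1# y)) ⟩
    (1# + x) + (- 1# + - y)  ≈⟨ +-congʳ (+-comm 1# x) ⟩
    (x + 1#) + (- 1# + - y)  ≈⟨ +-assoc x 1# _ ⟩
    x + (1# + (- 1# + - y))  ≈⟨ +-congˡ (sym (+-assoc 1# (- 1#) (- y))) ⟩
    x + ((1# + - 1#) + - y)  ≈⟨ +-congˡ (+-congʳ (-‿inverseʳ 1#)) ⟩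
    x + (0# + - y)           ≈⟨ +-congˡ (+-identityˡ (- y)) ⟩
    x + - y                  ∎

  fromℤ-⊖ : ∀ m n → fromℤ (m ⊖ n) ≈ fromℕ m - fromℕ n
  fromℤ-⊖ m       zero    = sym (trans (+-congˡ -0#≈0#) (+-identityʳ _))
  fromℤ-⊖ zero    (suc n) = sym (+-identityˡ _)
  fromℤ-⊖ (suc m) (suc n) = begin
    fromℤ (suc m ⊖ suc n)          ≡⟨ ≡.cong fromℤ (ℤ.[1+m]⊖[1+n]≡m⊖n m n) ⟩
    fromℤ (m ⊖ n)                  ≈⟨ fromℤ-⊖ m n ⟩
    fromℕ m - fromℕ n              ≈⟨ [1+x]-[1+y]≈x-y (fromℕ m) (fromℕ n) ⟨
    fromℕ (suc m) - fromℕ (suc n)  ∎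

  fromℤ-+-homo : ∀ i j → fromℤ (i ℤ.+ j) ≈ fromℤ i + fromℤ j
  fromℤ-+-homo (+ m)    (+ n)    = ×-homo-+ 1# m n
  fromℤ-+-homo (+ m)    -[1+ n ] = fromℤ-⊖ m (suc n)
  fromℤ-+-homo -[1+ m ] (+ n)    = trans (fromℤ-⊖ n (suc m)) (+-comm _ _)
  fromℤ-+-homo -[1+ m ] -[1+ n ] = begin
    - fromℕ (suc (suc (m ℕ.+ n)))          ≡⟨ ≡.cong (λ k → - fromℕ (suc k)) (ℕ.+-suc m n) ⟨
    - fromℕ (suc m ℕ.+ suc n)              ≈⟨ -‿cong (×-homo-+ 1# (suc m) (suc n)) ⟩
    - (fromℕ (suc m) + fromℕ (suc n))      ≈⟨ -‿+-comm _ _ ⟨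
    - fromℕ (suc m) + - fromℕ (suc n)      ∎

  signed : Sign → Carrier → Carrier
  signed Sign.+ x = x
  signed Sign.- x = - x

  signed-cong : ∀ s {x y} → x ≈ y → signed s x ≈ signed s y
  signed-cong Sign.+ x≈y = x≈y
  signed-cong Sign.- x≈y = -‿cong x≈y

  signed-* : ∀ s t x y → signed (s Sign.* t) (x * y) ≈ signed s x * signed t y
  signed-* Sign.+ Sign.+ x y = refl
  signed-* Sign.+ Sign.- x y = -‿distribʳ-* x y
  signed-* Sign.- Sign.+ x y = -‿distribˡ-* x y
  signed-* Sign.- Sign.- x y = begin
    x * y          ≈⟨ -‿involutive _ ⟨
    - - (x * y)    ≈⟨ -‿cong (-‿distribʳ-* x y) ⟩
    - (x * - y)    ≈⟨ -‿distribˡ-* x (- y) ⟩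
    - x * - y      ∎

  fromℤ-◃ : ∀ s n → fromℤ (s ◃ n) ≈ signed s (fromℕ n)
  fromℤ-◃ Sign.+ zero    = refl
  fromℤ-◃ Sign.- zero    = sym -0#≈0#
  fromℤ-◃ Sign.+ (suc n) = refl
  fromℤ-◃ Sign.- (suc n) = refl

  fromℤ≈signed : ∀ i → fromℤ i ≈ signed (ℤ.sign i) (fromℕ ∣ i ∣)
  fromℤ≈signed (+ n)    = refl
  fromℤ≈signed -[1+ n ] = refl

  fromℤ-*-homo : ∀ i j → fromℤ (i ℤ.* j) ≈ fromℤ i * fromℤ j
  fromℤ-*-homo i j = begin
    fromℤ (s ◃ ∣ i ∣ ℕ.* ∣ j ∣)             ≈⟨ fromℤ-◃ s (∣ i ∣ ℕ.* ∣ j ∣) ⟩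
    signed s (fromℕ (∣ i ∣ ℕ.* ∣ j ∣))      ≈⟨ signed-cong s (×1-homo-* ∣ i ∣ ∣ j ∣) ⟩
    signed s (fromℕ ∣ i ∣ * fromℕ ∣ j ∣)
                                           ≈⟨ signed-* (ℤ.sign i) (ℤ.sign j) (fromℕ ∣ i ∣) (fromℕ ∣ j ∣) ⟩
    signed (ℤ.sign i) (fromℕ ∣ i ∣) * signed (ℤ.sign j) (fromℕ ∣ j ∣)
                                           ≈⟨ *-cong (fromℤ≈signed i) (fromℤ≈signed j) ⟨
    fromℤ i * fromℤ j                      ∎
    where
    s = ℤ.sign i Sign.* ℤ.sign j

  fromℤ-homomorphism : ℤ.+-*-rawRing -Raw-AlmostCommutative⟶ fromCommutativeRing R
  fromℤ-homomorphism = record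
    { ⟦_⟧    = fromℤ
    ; +-homo = fromℤ-+-homo
    ; *-homo = fromℤ-*-homo
    ; -‿homo = fromℤ-‿homo
    ; 0-homo = refl
    ; 1-homo = +-identityʳ 1#
    }

  fromℤ-≟ : WeaklyDecidable (Induced-equivalence fromℤ-homomorphism)
  fromℤ-≟ i j with i ℤ.≟ j
  ... | yes ≡.refl = just refl
  ... | no _       = nothing

  open import Algebra.Solver.Ring ℤ.+-*-rawRing (fromCommutativeRing R) fromℤ-homomorphism fromℤ-≟
    public

module OrderedField (ℝ : RealField) where
  open RealField ℝ renaming (_≤_ to _≤ℝ_)
  open IsTotalOrder isTotalOrder using (total; antisym; isPartialOrder)
  open IsTotalOrder isTotalOrder public
    using () renaming (trans to ≤-trans; reflexive to ≤-reflexive)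

  commutativeRing : CommutativeRing 0ℓ 0ℓ
  commutativeRing = record { isCommutativeRing = isCommutativeRing }

  open CommutativeRing commutativeRing public using (_-_; +-comm)
  open CommutativeRing commutativeRing using (+-identityˡ; -‿inverseʳ; *-comm; *-identityˡ)
  open import Algebra.Properties.Ring (CommutativeRing.ring commutativeRing)
    using (-‿distribˡ-*)
  open IntegerCoefficients commutativeRing public using (Polynomial; solve; _:=_; _:+_; _:*_; :-_)
  open IntegerCoefficients commutativeRing using (con)

  poset : Poset 0ℓ 0ℓ 0ℓ
  poset = record { isPartialOrder = isPartialOrder }

  open import Relation.Binary.Reasoning.PartialOrder poset

  infix 4 _≤_ _<_

  -- Re-declared only to give it a fixity.
  _≤_ : Carrier → Carrier → Set
  _≤_ = _≤ℝ_

  _<_ : Carrier → Carrier → Set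
  x < y = ¬ (y ≤ x)

  <⇒≤ : ∀ {x y} → x < y → x ≤ y
  <⇒≤ {x} {y} x<y with total x y
  ... | inj₁ x≤y = x≤y
  ... | inj₂ y≤x = ⊥-elim (x<y y≤x)

  ≤∧≰⇒< : ∀ {x y z} → x ≤ z → ¬ (y ≤ z) → x < y
  ≤∧≰⇒< x≤z y≰z y≤x = y≰z (≤-trans y≤x x≤z)

  <⇒0<- : ∀ {x y} → x < y → 0# < y - x
  <⇒0<- {x} {y} x<y y-x≤0 = x<y (begin
    y            ≡⟨ solve 2 (λ x y → y := (y :+ :- x) :+ x) ≡.refl x y ⟩
    (y - x) + x  ≤⟨ +-mono-≤ x y-x≤0 ⟩
    0# + x       ≡⟨ +-identityˡ x ⟩
    x            ∎)

  x≤0⇒0≤-x : ∀ {x} → x ≤ 0# → 0# ≤ - x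
  x≤0⇒0≤-x {x} x≤0 = begin
    0#      ≡⟨ -‿inverseʳ x ⟨
    x - x   ≤⟨ +-mono-≤ (- x) x≤0 ⟩
    0# - x  ≡⟨ +-identityˡ (- x) ⟩
    - x     ∎

  0≤-x⇒x≤0 : ∀ {x} → 0# ≤ - x → x ≤ 0#
  0≤-x⇒x≤0 {x} 0≤-x = begin
    x         ≡⟨ +-identityˡ x ⟨
    0# + x    ≤⟨ +-mono-≤ x 0≤-x ⟩
    - x + x   ≡⟨ solve 1 (λ x → :- x :+ x := con (+ 0)) ≡.refl x ⟩
    0#        ∎

  0≤x*x : ∀ x → 0# ≤ x * x
  0≤x*x x with total 0# x
  ... | inj₁ 0≤x = *-nonneg 0≤x 0≤x
  ... | inj₂ x≤0 = begin
    0#         ≤⟨ *-nonneg (x≤0⇒0≤-x x≤0) (x≤0⇒0≤-x x≤0) ⟩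
    - x * - x  ≡⟨ solve 1 (λ x → :- x :* :- x := x :* x) ≡.refl x ⟩
    x * x      ∎

  x≤0∧0≤y⇒x*y≤0 : ∀ {x y} → x ≤ 0# → 0# ≤ y → x * y ≤ 0#
  x≤0∧0≤y⇒x*y≤0 {x} {y} x≤0 0≤y = 0≤-x⇒x≤0 (begin
    0#         ≤⟨ *-nonneg (x≤0⇒0≤-x x≤0) 0≤y ⟩
    - x * y    ≡⟨ -‿distribˡ-* x y ⟨
    - (x * y)  ∎)

  x≤x+y : ∀ {x y} → 0# ≤ y → x ≤ x + y
  x≤x+y {x} {y} 0≤y = begin
    x       ≡⟨ +-identityˡ x ⟨
    0# + x  ≤⟨ +-mono-≤ x 0≤y ⟩
    y + x   ≡⟨ +-comm y x ⟩
    x + y   ∎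

  +-nonneg : ∀ {x y} → 0# ≤ x → 0# ≤ y → 0# ≤ x + y
  +-nonneg 0≤x 0≤y = ≤-trans 0≤x (x≤x+y 0≤y)

  +-pos-nonneg : ∀ {x y} → 0# < x → 0# ≤ y → 0# < x + y
  +-pos-nonneg 0<x 0≤y x+y≤0 = 0<x (≤-trans (x≤x+y 0≤y) x+y≤0)

  0<⇒≢0 : ∀ {x} → 0# < x → x ≢ 0#
  0<⇒≢0 0<x ≡.refl = 0<x (IsTotalOrder.refl isTotalOrder)

  *-cancelˡ-≡0 : ∀ {x y} → x ≢ 0# → x * y ≡ 0# → y ≡ 0#
  *-cancelˡ-≡0 {x} {y} x≢0 xy≡0 with inverse x x≢0
  ... | x⁻¹ , xx⁻¹≡1 = begin-equality
    y              ≡⟨ *-identityˡ y ⟨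
    1# * y         ≡⟨ ≡.cong (_* y) xx⁻¹≡1 ⟨
    x * x⁻¹ * y    ≡⟨ solve 3 (λ x x⁻¹ y → x :* x⁻¹ :* y := x⁻¹ :* (x :* y)) ≡.refl x x⁻¹ y ⟩
    x⁻¹ * (x * y)  ≡⟨ ≡.cong (x⁻¹ *_) xy≡0 ⟩
    x⁻¹ * 0#       ≡⟨ solve 1 (λ x⁻¹ → x⁻¹ :* con (+ 0) := con (+ 0)) ≡.refl x⁻¹ ⟩
    0#             ∎

  x≢0⇒0<x*x : ∀ {x} → x ≢ 0# → 0# < x * x
  x≢0⇒0<x*x {x} x≢0 x*x≤0 = x≢0 (*-cancelˡ-≡0 x≢0 (antisym x*x≤0 (0≤x*x x)))

  *-pos : ∀ {x y} → 0# < x → 0# < y → 0# < x * y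
  *-pos 0<x 0<y xy≤0 =
    0<⇒≢0 0<y (*-cancelˡ-≡0 (0<⇒≢0 0<x) (antisym xy≤0 (*-nonneg (<⇒≤ 0<x) (<⇒≤ 0<y))))

  SameSign : Carrier → Carrier → Set
  SameSign x y = 0# < x * y

  sameSign-sym : Symmetric SameSign
  sameSign-sym {x} {y} = ≡.subst (0# <_) (*-comm x y)

  sameSign-trans : Transitive SameSign
  sameSign-trans {x} {y} {z} x∼y y∼z xz≤0 = *-pos x∼y y∼z (begin
    (x * y) * (y * z)  ≡⟨ solve 3 (λ x y z → (x :* y) :* (y :* z) := (x :* z) :* (y :* y))
                                 ≡.refl x y z ⟩
    (x * z) * (y * y)  ≤⟨ x≤0∧0≤y⇒x*y≤0 xz≤0 (0≤x*x y) ⟩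
    0#                 ∎)

  ¬oddSignCycle : ∀ {a b c d e f} → SameSign a b → SameSign c d → SameSign e f →
                  SameSign a (- c) → SameSign b (- e) → SameSign d (- f) → ⊥
  -- The product of the three agreements is positive, that of the three reversals is its negative.
  ¬oddSignCycle {a} {b} {c} {d} {e} {f} a∼b c∼d e∼f a∼-c b∼-e d∼-f =
    *-pos (*-pos a∼b c∼d) e∼f (0≤-x⇒x≤0 (begin
      0#                                 ≤⟨ <⇒≤ (*-pos (*-pos a∼-c b∼-e) d∼-f) ⟩
      (a * - c) * (b * - e) * (d * - f)  ≡⟨ solve 6 (λ a b c d e f →
                                              (a :* :- c) :* (b :* :- e) :* (d :* :- f)
                                              := :- ((a :* b) :* (c :* d) :* (e :* f)))
                                            ≡.refl a b c d e f ⟩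
      - ((a * b) * (c * d) * (e * f))    ∎))

module Plane (ℝ : RealField) where
  open RealField ℝ using (Carrier; _+_; _*_; -_; 0#; *-nonneg)
  open Geometry ℝ
  open OrderedField ℝ

  infixl 6 _-ᵥ_

  _-ᵥ_ : Point → Point → Point
  (x₁ , x₂) -ᵥ (y₁ , y₂) = x₁ - y₁ , x₂ - y₂

  cross : Point → Point → Carrier
  cross (x₁ , x₂) (y₁ , y₂) = x₁ * y₂ - x₂ * y₁

  side : Halfplane → Point → Point → Carrier
  side h p y = cross (w h) (y -ᵥ p)

  0≤⟨v,v⟩ : ∀ v → 0# ≤ ⟨ v , v ⟩
  0≤⟨v,v⟩ (v₁ , v₂) = +-nonneg (0≤x*x v₁) (0≤x*x v₂)

  0<⟨v,v⟩ : ∀ {v} → v ≢ origin → 0# < ⟨ v , v ⟩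
  0<⟨v,v⟩ {v₁ , v₂} v≢0 ⟨v,v⟩≤0 =
    x≢0⇒0<x*x (λ v₁≡0 → x≢0⇒0<x*x (λ v₂≡0 → v≢0 (≡.cong₂ _,_ v₁≡0 v₂≡0)) v₂²≤0) v₁²≤0
    where
    v₁²≤0 : v₁ * v₁ ≤ 0#
    v₁²≤0 = ≤-trans (x≤x+y (0≤x*x v₂)) ⟨v,v⟩≤0
    v₂²≤0 : v₂ * v₂ ≤ 0#
    v₂²≤0 = ≤-trans (≤-trans (x≤x+y (0≤x*x v₁)) (≤-reflexive (+-comm _ _))) ⟨v,v⟩≤0

  module _ {n : ℕ} where
    _-ₚ_ : Polynomial n × Polynomial n → Polynomial n × Polynomial n → Polynomial n × Polynomial n
    (x₁ , x₂) -ₚ (y₁ , y₂) = x₁ :+ :- y₁ , x₂ :+ :- y₂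

    dotₚ crossₚ : Polynomial n × Polynomial n → Polynomial n × Polynomial n → Polynomial n
    dotₚ (x₁ , x₂) (y₁ , y₂) = x₁ :* y₁ :+ x₂ :* y₂
    crossₚ (x₁ , x₂) (y₁ , y₂) = x₁ :* y₂ :+ :- (x₂ :* y₁)

  dot-sub : ∀ v x y → ⟨ v , x ⟩ - ⟨ v , y ⟩ ≡ ⟨ v , x -ᵥ y ⟩
  dot-sub (v₁ , v₂) (x₁ , x₂) (y₁ , y₂) = solve 6 (λ v₁ v₂ x₁ x₂ y₁ y₂ →
      dotₚ (v₁ , v₂) (x₁ , x₂) :+ :- dotₚ (v₁ , v₂) (y₁ , y₂)
      := dotₚ (v₁ , v₂) ((x₁ , x₂) -ₚ (y₁ , y₂)))
    ≡.refl v₁ v₂ x₁ x₂ y₁ y₂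

  -- Both identities are instances of Binet–Cauchy: ⟨a,c⟩⟨b,d⟩ − ⟨a,d⟩⟨b,c⟩ = (a × b)(c × d).
  binet-cauchy-side : ∀ v u p y →
    cross v (y -ᵥ p) * - cross v u ≡ ⟨ v , v ⟩ * ⟨ u , p -ᵥ y ⟩ + ⟨ v , y -ᵥ p ⟩ * ⟨ u , v ⟩
  binet-cauchy-side (v₁ , v₂) (u₁ , u₂) (p₁ , p₂) (y₁ , y₂) = solve 8 (λ v₁ v₂ u₁ u₂ p₁ p₂ y₁ y₂ →
      let v = v₁ , v₂; u = u₁ , u₂; p = p₁ , p₂; y = y₁ , y₂ in
      crossₚ v (y -ₚ p) :* :- crossₚ v u
      := dotₚ v v :* dotₚ u (p -ₚ y) :+ dotₚ v (y -ₚ p) :* dotₚ u v)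
    ≡.refl v₁ v₂ u₁ u₂ p₁ p₂ y₁ y₂

  binet-cauchy-pair : ∀ v u p q →
    cross v (q -ᵥ p) * - cross u (p -ᵥ q) ≡
    ⟨ v , q -ᵥ p ⟩ * ⟨ u , p -ᵥ q ⟩ + ⟨ v , u ⟩ * ⟨ q -ᵥ p , q -ᵥ p ⟩
  binet-cauchy-pair (v₁ , v₂) (u₁ , u₂) (p₁ , p₂) (q₁ , q₂) = solve 8 (λ v₁ v₂ u₁ u₂ p₁ p₂ q₁ q₂ →
      let v = v₁ , v₂; u = u₁ , u₂; p = p₁ , p₂; q = q₁ , q₂ in
      crossₚ v (q -ₚ p) :* :- crossₚ u (p -ₚ q)
      := dotₚ v (q -ₚ p) :* dotₚ u (p -ₚ q) :+ dotₚ v u :* dotₚ (q -ₚ p) (q -ₚ p))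
    ≡.refl v₁ v₂ u₁ u₂ p₁ p₂ q₁ q₂

  0<⟨w,y-p⟩ : ∀ {h p y} → p ∈ₕ h → ¬ (y ∈ₕ h) → 0# < ⟨ w h , y -ᵥ p ⟩
  0<⟨w,y-p⟩ {h} {p} {y} p∈h y∉h = ≡.subst (0# <_) (dot-sub (w h) y p) (<⇒0<- (≤∧≰⇒< p∈h y∉h))

  side-sameSign : ∀ {h k p y} → p ∈ₕ h → ¬ (y ∈ₕ h) → y ∈ₕ k → ¬ (p ∈ₕ k) → 0# ≤ ⟨ w k , w h ⟩ →
                  SameSign (side h p y) (- cross (w h) (w k))
  side-sameSign {h} {k} {p} {y} p∈h y∉h y∈k p∉k 0≤⟨wₖ,wₕ⟩ =
    ≡.subst (0# <_) (≡.sym (binet-cauchy-side (w h) (w k) p y))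
      (+-pos-nonneg (*-pos (0<⟨v,v⟩ (w≢0 h)) (0<⟨w,y-p⟩ {k} y∈k p∉k))
                    (*-nonneg (<⇒≤ (0<⟨w,y-p⟩ {h} p∈h y∉h)) 0≤⟨wₖ,wₕ⟩))

  side-opposite : ∀ {h k p q} → p ∈ₕ h → q ∈ₕ k → ¬ (q ∈ₕ h) → ¬ (p ∈ₕ k) → 0# ≤ ⟨ w h , w k ⟩ →
                  SameSign (side h p q) (- side k q p)
  side-opposite {h} {k} {p} {q} p∈h q∈k q∉h p∉k 0≤⟨wₕ,wₖ⟩ =
    ≡.subst (0# <_) (≡.sym (binet-cauchy-pair (w h) (w k) p q))
      (+-pos-nonneg (*-pos (0<⟨w,y-p⟩ {h} p∈h q∉h) (0<⟨w,y-p⟩ {k} q∈k p∉k))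
                    (*-nonneg 0≤⟨wₕ,wₖ⟩ (0≤⟨v,v⟩ (q -ᵥ p))))

++-∷∷ : ∀ {A : Set} (ys : List A) {a b zs} → ∃₂ λ x y → ∃ λ rest → ys ++ a ∷ b ∷ zs ≡ x ∷ y ∷ rest
++-∷∷ []           = _ , _ , _ , ≡.refl
++-∷∷ (y ∷ [])     = _ , _ , _ , ≡.refl
++-∷∷ (y ∷ z ∷ ys) = _ , _ , _ , ≡.refl

module _ {A : Set} {R : A → A → Set} (sym : Symmetric R) (trans : Transitive R) where

  Linked⇒related : ∀ {x y zs a b} → Linked R (x ∷ y ∷ zs) → a ∈ x ∷ y ∷ zs → b ∈ x ∷ y ∷ zs → R a b
  Linked⇒related (Rxy ∷ linked) a∈ b∈ = trans (sym (All.lookup Rx a∈)) (All.lookup Rx b∈)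
    where
    Rx = Linked.Linked⇒All trans (trans Rxy (sym Rxy)) (Rxy ∷ linked)

module _ (G : Graph) where

  endpoints∈path : ∀ {xs} e → ContainsEdge G xs e → Edge.u e ∈ xs × Edge.v e ∈ xs
  endpoints∈path _ (ys , _ , inj₁ ≡.refl) =
    ∈-++⁺ʳ ys (here ≡.refl) , ∈-++⁺ʳ ys (there (here ≡.refl))
  endpoints∈path _ (ys , _ , inj₂ ≡.refl) =
    ∈-++⁺ʳ ys (there (here ≡.refl)) , ∈-++⁺ʳ ys (here ≡.refl)

  path-∷∷ : ∀ {xs} e → ContainsEdge G xs e → ∃₂ λ x y → ∃ λ zs → xs ≡ x ∷ y ∷ zs
  path-∷∷ _ (ys , _ , inj₁ ≡.refl) = ++-∷∷ ys
  path-∷∷ _ (ys , _ , inj₂ ≡.refl) = ++-∷∷ ys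

module _ {G H : Graph} (iso : G ≅ H) where
  open _≅_ iso

  private
    to-injective : ∀ {x y} → to x ≡ to y → x ≡ y
    to-injective = Injection.injective (↔⇒↣ bij)

  mapEdge : Edge G → Edge H
  mapEdge e = edge (to (Edge.u e)) (to (Edge.v e)) (adj-to _ _ (Edge.uv e))

  map-SameEdge⁻ : ∀ e f → SameEdge H (mapEdge e) (mapEdge f) → SameEdge G e f
  map-SameEdge⁻ _ _ =
    Sum.map (Product.map to-injective to-injective) (Product.map to-injective to-injective)

  map-ContainsEdge : ∀ {xs} e → ContainsEdge G xs e → ContainsEdge H (map to xs) (mapEdge e)
  map-ContainsEdge e (ys , zs , inj₁ ≡.refl) =
    map to ys , map to zs , inj₁ (map-++ to ys (Edge.u e ∷ Edge.v e ∷ zs))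
  map-ContainsEdge e (ys , zs , inj₂ ≡.refl) =
    map to ys , map to zs , inj₂ (map-++ to ys (Edge.v e ∷ Edge.u e ∷ zs))

  map-GoodPath : ∀ e f g → GoodPath G e f g → GoodPath H (mapEdge e) (mapEdge f) (mapEdge g)
  map-GoodPath e f g (xs , (distinct , linked) , ce , cf , nonadjacent) =
      map to xs
    , (Unique.map⁺ to-injective distinct , Linked.map⁺ (Linked.map (adj-to _ _) linked))
    , map-ContainsEdge e ce
    , map-ContainsEdge f cf
    , All.map⁺ (All.map (λ ¬adj adj → ¬adj (Sum.map (adj-from _ _) (adj-from _ _) adj)) nonadjacent)

  map-HasEdgeAsteroidTriple : HasEdgeAsteroidTriple G → HasEdgeAsteroidTriple H
  map-HasEdgeAsteroidTriple (e₁ , e₂ , e₃ , e₁≠e₂ , e₁≠e₃ , e₂≠e₃ , γ₁₂ , γ₁₃ , γ₂₃) =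
      mapEdge e₁ , mapEdge e₂ , mapEdge e₃
    , e₁≠e₂ ∘ map-SameEdge⁻ e₁ e₂ , e₁≠e₃ ∘ map-SameEdge⁻ e₁ e₃ , e₂≠e₃ ∘ map-SameEdge⁻ e₂ e₃
    , map-GoodPath e₁ e₂ e₃ γ₁₂ , map-GoodPath e₁ e₃ e₂ γ₁₃ , map-GoodPath e₂ e₃ e₁ γ₂₃

module Incidence (ℝ : RealField) (C : Geometry.Config ℝ) (positive : Geometry.Positive ℝ C) where
  open RealField ℝ using (Carrier; -_)
  open Geometry ℝ
  open OrderedField ℝ using (SameSign; sameSign-sym; sameSign-trans; ¬oddSignCycle)
  open Plane ℝ using (cross; side; side-sameSign; side-opposite)

  Vertex : Set
  Vertex = Fin (a C) ⊎ Fin (b C)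

  point : Edge (IncGraph C) → Fin (a C)
  point (edge _ _ (ph i _ _))  = i
  point (edge _ _ (hp′ i _ _)) = i

  halfplane : Edge (IncGraph C) → Fin (b C)
  halfplane (edge _ _ (ph _ j _))  = j
  halfplane (edge _ _ (hp′ _ j _)) = j

  incident : ∀ e → pt C (point e) ∈ₕ hp C (halfplane e)
  incident (edge _ _ (ph _ _ i∈j))  = i∈j
  incident (edge _ _ (hp′ _ _ i∈j)) = i∈j

  point∈path : ∀ {xs} e → ContainsEdge (IncGraph C) xs e → inj₁ (point e) ∈ xs
  point∈path e@(edge _ _ (ph _ _ _))  ce = proj₁ (endpoints∈path (IncGraph C) e ce)
  point∈path e@(edge _ _ (hp′ _ _ _)) ce = proj₂ (endpoints∈path (IncGraph C) e ce)

  Avoids : Edge (IncGraph C) → Vertex → Set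
  Avoids g (inj₁ i) = ¬ (pt C i ∈ₕ hp C (halfplane g))
  Avoids g (inj₂ k) = ¬ (pt C (point g) ∈ₕ hp C k)

  nonadjacent⇒avoids : ∀ g x → ¬ AdjToEnd (IncGraph C) g x → Avoids g x
  nonadjacent⇒avoids (edge _ _ (ph _ j _))  (inj₁ i) ¬adj i∈j = ¬adj (inj₂ (ph i j i∈j))
  nonadjacent⇒avoids (edge _ _ (ph i _ _))  (inj₂ k) ¬adj i∈k = ¬adj (inj₁ (hp′ i k i∈k))
  nonadjacent⇒avoids (edge _ _ (hp′ _ j _)) (inj₁ i) ¬adj i∈j = ¬adj (inj₁ (ph i j i∈j))
  nonadjacent⇒avoids (edge _ _ (hp′ i _ _)) (inj₂ k) ¬adj i∈k = ¬adj (inj₂ (hp′ i k i∈k))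

  -- A halfplane vertex k gets the sign that side-sameSign forces on the points of k.
  sign : Edge (IncGraph C) → Vertex → Carrier
  sign g (inj₁ i) = side (hp C (halfplane g)) (pt C (point g)) (pt C i)
  sign g (inj₂ k) = - cross (w (hp C (halfplane g))) (w (hp C k))

  adjacent-sameSign : ∀ g {x y} → IncAdj C x y → Avoids g x → Avoids g y →
                      SameSign (sign g x) (sign g y)
  adjacent-sameSign g (ph i k i∈k) i∉g g∉k =
    side-sameSign {hp C (halfplane g)} {hp C k} (incident g) i∉g i∈k g∉k (positive k (halfplane g))
  adjacent-sameSign g (hp′ i k i∈k) g∉k i∉g =
    sameSign-sym (adjacent-sameSign g (ph i k i∈k) i∉g g∉k)

  linked-sameSign : ∀ g {xs} → Linked (IncAdj C) xs → All (Avoids g) xs →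
                    Linked (SameSign on sign g) xs
  linked-sameSign g []             _                                 = []
  linked-sameSign g [-]            _                                 = [-]
  linked-sameSign g (x∼y ∷ linked) (x-avoids ∷ avoids@(y-avoids ∷ _)) =
    adjacent-sameSign g x∼y x-avoids y-avoids ∷ linked-sameSign g linked avoids

  goodPath-avoids : ∀ e f g → GoodPath (IncGraph C) e f g →
                    Avoids g (inj₁ (point e)) × Avoids g (inj₁ (point f))
  goodPath-avoids e f g (_ , _ , ce , cf , nonadjacent) =
    avoids (point∈path e ce) , avoids (point∈path f cf)
    where
    avoids : ∀ {x} → x ∈ _ → Avoids g x
    avoids x∈ = nonadjacent⇒avoids g _ (All.lookup nonadjacent x∈)

  goodPath-sameSign : ∀ e f g → GoodPath (IncGraph C) e f g →
                      SameSign (sign g (inj₁ (point e))) (sign g (inj₁ (point f)))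
  goodPath-sameSign e f g (xs , (_ , linked) , ce , cf , nonadjacent) with path-∷∷ (IncGraph C) e ce
  ... | _ , _ , _ , ≡.refl =
    Linked⇒related sameSign-sym sameSign-trans
      (linked-sameSign g linked (All.map (nonadjacent⇒avoids g _) nonadjacent))
      (point∈path e ce) (point∈path f cf)

  sign-opposite : ∀ e f → Avoids e (inj₁ (point f)) → Avoids f (inj₁ (point e)) →
                  SameSign (sign e (inj₁ (point f))) (- sign f (inj₁ (point e)))
  sign-opposite e f f∉e e∉f =
    side-opposite {hp C (halfplane e)} {hp C (halfplane f)}
      (incident e) (incident f) f∉e e∉f (positive (halfplane e) (halfplane f))

  -- The three edges need not be distinct for the contradiction.
  ¬edgeAsteroidTriple : ¬ HasEdgeAsteroidTriple (IncGraph C)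
  ¬edgeAsteroidTriple (e₁ , e₂ , e₃ , _ , _ , _ , γ₁₂ , γ₁₃ , γ₂₃) =
    ¬oddSignCycle (goodPath-sameSign e₂ e₃ e₁ γ₂₃) (goodPath-sameSign e₁ e₃ e₂ γ₁₃)
      (goodPath-sameSign e₁ e₂ e₃ γ₁₂)
      (sign-opposite e₁ e₂ p₂∉h₁ p₁∉h₂) (sign-opposite e₁ e₃ p₃∉h₁ p₁∉h₃)
      (sign-opposite e₂ e₃ p₃∉h₂ p₂∉h₃)
    where
    p₂∉h₁ = proj₁ (goodPath-avoids e₂ e₃ e₁ γ₂₃)
    p₃∉h₁ = proj₂ (goodPath-avoids e₂ e₃ e₁ γ₂₃)
    p₁∉h₂ = proj₁ (goodPath-avoids e₁ e₃ e₂ γ₁₃)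
    p₃∉h₂ = proj₂ (goodPath-avoids e₁ e₃ e₂ γ₁₃)
    p₁∉h₃ = proj₁ (goodPath-avoids e₁ e₂ e₃ γ₁₂)
    p₂∉h₃ = proj₂ (goodPath-avoids e₁ e₂ e₃ γ₁₂)

lemma4p7 : (ℝ : RealField) (G : Graph) → PositivePHIGraph ℝ G → ¬ HasEdgeAsteroidTriple G
lemma4p7 ℝ _ (C , positive , iso) =
  Incidence.¬edgeAsteroidTriple ℝ C positive ∘ map-HasEdgeAsteroidTriple iso
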